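{- Let $n\ge1$, $m\ge 2$ and $1\le r\le m$ be integers. Then $T(n,m,r)$ is bipartite if and only if both $m$ and $n+r$ are even.
   Context: Write $Z_k=\{0,1,\dots,k-1\}$. $T(n,m,r)$ is the graph with vertex set $\{v_{i,j}: i\in Z_n, j\in Z_m\}$ (second index modulo $m$) whose edges are the horizontal edges $v_{i,j}v_{i,j+1}$ ($i\in Z_n$, $j\in Z_m$) and the vertical edges $v_{i,j}v_{i+1,j}$ ($0\le i\le n-2$, $j\in Z_m$) and $v_{n-1,j}v_{0,j+r}$ ($j\in Z_m$) (the quadriculated torus obtained from an $n\times m$ chessboard by gluing left and right sides and gluing top and bottom with a torsion of $r$ squares). -}

module Defs where

open import Data.Nat using (ℕ; suc; _+_; _<_; NonZero)
open import Data.Nat.DivMod using (_%_)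
open import Data.Fin using (Fin; toℕ)
open import Data.Bool using (Bool)
open import Data.Product using (_×_; _,_; Σ)
open import Relation.Binary.PropositionalEquality using (_≡_; _≢_)

Vertex : ℕ → ℕ → Set
Vertex n m = Fin n × Fin m

_⊕[_]_ : ∀ {m} → Fin m → ℕ → Fin m → Set
_⊕[_]_ {m} j k j' = Σ (NonZero m) λ nz → toℕ j' ≡ (let instance _ = nz in (toℕ j + k) % m)

-- Edges of T(n,m,r), as an (undirected-by-use) edge relation; each edge
-- v_{i,j}v_{i',j'} is recorded in one orientation.
data Edge (n m r : ℕ) : Vertex n m → Vertex n m → Set where
  horiz : ∀ (i : Fin n) (j j' : Fin m) → j ⊕[ 1 ] j' → Edge n m r (i , j) (i , j')
  vert  : ∀ (i i' : Fin n) (j : Fin m) → toℕ i' ≡ suc (toℕ i) → Edge n m r (i , j) (i' , j)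
  twist : ∀ (i i' : Fin n) (j j' : Fin m) → suc (toℕ i) ≡ n → toℕ i' ≡ 0 →
          j ⊕[ r ] j' → Edge n m r (i , j) (i' , j')

IsBipartite : ∀ {V : Set} → (V → V → Set) → Set
IsBipartite {V} E = Σ (V → Bool) λ c → ∀ u v → E u v → c u ≢ c v

T-bipartite : ℕ → ℕ → ℕ → Set
T-bipartite n m r = IsBipartite (Edge n m r)

-- A properly 2-coloured graph has no closed walk of odd length.  In T(n,m,r)
-- the row v_{0,0} … v_{0,m-1} v_{0,0} is a closed walk of length m, and going
-- down the first column, across the twisted edge to v_{0,r mod m} and back along
-- the top row is a closed walk of length n + (r mod m) ≡ n + r (mod 2) once m is
-- even.  Conversely, if m and n + r are even then the parity of i + j is a proper
-- 2-colouring: the wrap-around of a row changes j by m - 1, and the twisted edge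
-- changes i + j by 1 - n + r.
module Submission where

open import Defs
open import Data.Bool using (Bool; true; false)
open import Data.Fin using (toℕ; fromℕ<; zero)
open import Data.Fin.Properties using (toℕ-fromℕ<)
open import Data.Nat using (ℕ; zero; suc; _+_; _*_; _<_; _≤_; s≤s; z≤n; NonZero; parity)
open import Data.Nat.Divisibility using (_∣_; divides; _∣0; ∣-refl; ∣m∣n⇒∣m+n; ∣n⇒∣m*n)
open import Data.Nat.DivMod using (_%_; _/_; m≡m%n+[m/n]*n; m<n⇒m%n≡m; n%n≡0; m%n<n)
open import Data.Nat.Properties as ℕ using (<⇒≤; ≤-refl; +-assoc; +-suc)
open import Data.Parity.Base as ℙ using (Parity; 0ℙ; 1ℙ; _⁻¹)
open import Data.Parity.Properties
  using (+-homo-+; *-homo-*; *-zeroʳ; +-identityʳ; +-cancelʳ-≡; p+p≡0ℙ; p≢p⁻¹; ⁻¹-selfInverse)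
  renaming (+-assoc to ℙ-+-assoc)
open import Data.Product using (_×_; _,_)
open import Function using (_∘_)
open import Function.Bundles using (_⇔_; mk⇔)
open import Function.Definitions using (Injective)
open import Relation.Binary.Construct.Closure.Symmetric using (SymClosure; fwd; bwd; symmetric)
open import Relation.Binary.PropositionalEquality
open import Relation.Nullary.Negation using (contradiction)

private
  variable
    V C D : Set
    E : V → V → Set
    u v w : V
    a ℓ ℓ′ : ℕ

ProperColouring : (V → V → Set) → (V → C) → Set
ProperColouring E c = ∀ u v → E u v → c u ≢ c v

recolour : {f : C → D} → Injective _≡_ _≡_ f → {c : V → C} →
           ProperColouring E c → ProperColouring E (f ∘ c)
recolour f-injective proper u v e = proper u v e ∘ f-injective

toParity : Bool → Parity
toParity false = 0ℙ
toParity true  = 1ℙ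

fromParity : Parity → Bool
fromParity 0ℙ = false
fromParity 1ℙ = true

toParity-injective : Injective _≡_ _≡_ toParity
toParity-injective {false} {false} _ = refl
toParity-injective {true}  {true}  _ = refl

fromParity-injective : Injective _≡_ _≡_ fromParity
fromParity-injective {0ℙ} {0ℙ} _ = refl
fromParity-injective {1ℙ} {1ℙ} _ = refl

≢⇒≡⁻¹ : {p q : Parity} → p ≢ q → q ≡ p ⁻¹
≢⇒≡⁻¹ {0ℙ} {0ℙ} p≢q = contradiction refl p≢q
≢⇒≡⁻¹ {0ℙ} {1ℙ} _   = refl
≢⇒≡⁻¹ {1ℙ} {0ℙ} _   = refl
≢⇒≡⁻¹ {1ℙ} {1ℙ} p≢q = contradiction refl p≢q

parity-suc : ∀ n → parity (suc n) ≡ parity n ⁻¹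
parity-suc n = +-homo-+ 1 n

parity≡0ℙ⇒2∣ : ∀ n → parity n ≡ 0ℙ → 2 ∣ n
parity≡0ℙ⇒2∣ zero          _  = 2 ∣0
parity≡0ℙ⇒2∣ (suc zero)    ()
parity≡0ℙ⇒2∣ (suc (suc n)) eq = ∣m∣n⇒∣m+n ∣-refl (parity≡0ℙ⇒2∣ n eq)

2∣⇒parity≡0ℙ : ∀ {n} → 2 ∣ n → parity n ≡ 0ℙ
2∣⇒parity≡0ℙ (divides q refl) = trans (*-homo-* q 2) (*-zeroʳ (parity q))

parity-+-cong : ∀ z {x y} → parity x ≡ parity y → parity (z + x) ≡ parity (z + y)
parity-+-cong z {x} {y} eq = begin
  parity (z + x)          ≡⟨ +-homo-+ z x ⟩
  parity z ℙ.+ parity x   ≡⟨ cong (parity z ℙ.+_) eq ⟩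
  parity z ℙ.+ parity y   ≡⟨ +-homo-+ z y ⟨
  parity (z + y)          ∎
  where open ≡-Reasoning

parity-+-even : ∀ x {y} → 2 ∣ y → parity (x + y) ≡ parity x
parity-+-even x {y} 2∣y = begin
  parity (x + y)          ≡⟨ +-homo-+ x y ⟩
  parity x ℙ.+ parity y   ≡⟨ cong (parity x ℙ.+_) (2∣⇒parity≡0ℙ 2∣y) ⟩
  parity x ℙ.+ 0ℙ         ≡⟨ +-identityʳ (parity x) ⟩
  parity x                ∎
  where open ≡-Reasoning

parity-% : ∀ x {d} .{{_ : NonZero d}} → 2 ∣ d → parity (x % d) ≡ parity x
parity-% x {d} 2∣d = begin
  parity (x % d)                  ≡⟨ parity-+-even (x % d) (∣n⇒∣m*n (x / d) 2∣d) ⟨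
  parity (x % d + (x / d) * d)    ≡⟨ cong parity (m≡m%n+[m/n]*n x d) ⟨
  parity x                        ∎
  where open ≡-Reasoning

2∣+⇒parity≡ : ∀ x y → 2 ∣ x + y → parity x ≡ parity y
2∣+⇒parity≡ x y 2∣x+y = +-cancelʳ-≡ (parity y) (parity x) (parity y) (begin
  parity x ℙ.+ parity y   ≡⟨ +-homo-+ x y ⟨
  parity (x + y)          ≡⟨ 2∣⇒parity≡0ℙ 2∣x+y ⟩
  0ℙ                      ≡⟨ p+p≡0ℙ (parity y) ⟨
  parity y ℙ.+ parity y   ∎)
  where open ≡-Reasoning

toℕ-fromℕ<-suc : ∀ {m} (p : suc a < m) → toℕ (fromℕ< p) ≡ suc (toℕ (fromℕ< (<⇒≤ p)))
toℕ-fromℕ<-suc p = trans (toℕ-fromℕ< p) (cong suc (sym (toℕ-fromℕ< (<⇒≤ p))))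

infixr 5 _∷_ _++_

data Walk {V : Set} (E : V → V → Set) : V → V → ℕ → Set where
  []  : Walk E u u 0
  _∷_ : SymClosure E u v → Walk E v w ℓ → Walk E u w (suc ℓ)

_++_ : Walk E u v ℓ → Walk E v w ℓ′ → Walk E u w (ℓ + ℓ′)
[]      ++ w′ = w′
(e ∷ w) ++ w′ = e ∷ (w ++ w′)

reverse : Walk E u v ℓ → Walk E v u ℓ
reverse [] = []
reverse {E = E} {ℓ = suc ℓ} (e ∷ w) =
  subst (Walk E _ _) (ℕ.+-comm ℓ 1) (reverse w ++ symmetric E e ∷ [])

module _ {c : V → Parity} (proper : ProperColouring E c) where

  adjacent-⁻¹ : SymClosure E u v → c v ≡ c u ⁻¹
  adjacent-⁻¹ (fwd e) = ≢⇒≡⁻¹ (proper _ _ e)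
  adjacent-⁻¹ (bwd e) = sym (⁻¹-selfInverse (sym (≢⇒≡⁻¹ (proper _ _ e))))

  walk-parity : Walk E u v ℓ → c v ≡ parity ℓ ℙ.+ c u
  walk-parity [] = refl
  walk-parity {u = u} {v = v} (_∷_ {ℓ = ℓ} e w) = begin
    c v                             ≡⟨ walk-parity w ⟩
    parity ℓ ℙ.+ c _                ≡⟨ cong (parity ℓ ℙ.+_) (adjacent-⁻¹ e) ⟩
    parity ℓ ℙ.+ (parity 1 ℙ.+ c u) ≡⟨ ℙ-+-assoc (parity ℓ) (parity 1) (c u) ⟨
    (parity ℓ ℙ.+ parity 1) ℙ.+ c u ≡⟨ cong (ℙ._+ c u) (+-homo-+ ℓ 1) ⟨
    parity (ℓ + 1) ℙ.+ c u          ≡⟨ cong (λ n → parity n ℙ.+ c u) (ℕ.+-comm ℓ 1) ⟩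
    parity (suc ℓ) ℙ.+ c u          ∎
    where open ≡-Reasoning

  closedWalk-even : Walk E u u ℓ → 2 ∣ ℓ
  closedWalk-even {u = u} {ℓ = ℓ} w =
    parity≡0ℙ⇒2∣ ℓ (+-cancelʳ-≡ (c u) (parity ℓ) 0ℙ (sym (walk-parity w)))

module Torus (n′ k r : ℕ) where

  N M : ℕ
  N = suc n′
  M = suc (suc k)

  T : Vertex N M → Vertex N M → Set
  T = Edge N M r

  fromℕ<-⊕1 : (p : suc a < M) → fromℕ< (<⇒≤ p) ⊕[ 1 ] fromℕ< p
  fromℕ<-⊕1 {a} p = _ , (begin
    toℕ (fromℕ< p)                   ≡⟨ toℕ-fromℕ< p ⟩
    suc a                            ≡⟨ m<n⇒m%n≡m p ⟨
    suc a % M                        ≡⟨ cong (_% M) (ℕ.+-comm 1 a) ⟩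
    (a + 1) % M                      ≡⟨ cong (λ x → (x + 1) % M) (toℕ-fromℕ< (<⇒≤ p)) ⟨
    (toℕ (fromℕ< (<⇒≤ p)) + 1) % M   ∎)
    where open ≡-Reasoning

  last⊕1 : fromℕ< {suc k} ≤-refl ⊕[ 1 ] zero
  last⊕1 = _ , sym (begin
    (toℕ (fromℕ< {suc k} ≤-refl) + 1) % M ≡⟨ cong (λ x → (x + 1) % M) (toℕ-fromℕ< {suc k} {M} ≤-refl) ⟩
    (suc k + 1) % M                       ≡⟨ cong (_% M) (ℕ.+-comm (suc k) 1) ⟩
    M % M                                 ≡⟨ n%n≡0 M ⟩
    0                                     ∎)
    where open ≡-Reasoning

  rowWalk : ∀ i a (p : a < M) → Walk T (i , fromℕ< p) (i , zero) a
  rowWalk i zero    p = []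
  rowWalk i (suc a) p = bwd (horiz i _ _ (fromℕ<-⊕1 p)) ∷ rowWalk i a (<⇒≤ p)

  columnWalk : ∀ j a (p : a < N) → Walk T (fromℕ< p , j) (zero , j) a
  columnWalk j zero    p = []
  columnWalk j (suc a) p = bwd (vert _ _ j (toℕ-fromℕ<-suc p)) ∷ columnWalk j a (<⇒≤ p)

  rowCycle : Walk T (zero , zero) (zero , zero) M
  rowCycle = bwd (horiz zero _ _ last⊕1) ∷ rowWalk zero (suc k) ≤-refl

  twistCycle : Walk T (zero , zero) (zero , zero) (N + r % M)
  twistCycle = subst (Walk T _ _) (+-suc n′ (r % M))
    (reverse (columnWalk zero n′ ≤-refl)
      ++ fwd (twist _ zero zero _ (cong suc (toℕ-fromℕ< ≤-refl)) refl (_ , toℕ-fromℕ< (m%n<n r M)))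
      ∷ rowWalk zero (r % M) (m%n<n r M))

  parity-colouring⇒even : {c : Vertex N M → Parity} → ProperColouring T c →
                          2 ∣ M × 2 ∣ N + r
  parity-colouring⇒even proper = 2∣M , 2∣N+r
    where
    2∣M : 2 ∣ M
    2∣M = closedWalk-even proper rowCycle
    2∣N+r : 2 ∣ N + r
    2∣N+r = parity≡0ℙ⇒2∣ (N + r) (begin
      parity (N + r)       ≡⟨ parity-+-cong N (parity-% r 2∣M) ⟨
      parity (N + r % M)   ≡⟨ 2∣⇒parity≡0ℙ (closedWalk-even proper twistCycle) ⟩
      0ℙ                   ∎)
      where open ≡-Reasoning

  χ : Vertex N M → Parity
  χ (i , j) = parity (toℕ i + toℕ j)

  module _ (2∣M : 2 ∣ M) (2∣N+r : 2 ∣ N + r) where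

    χ-edge : T u v → χ v ≡ χ u ⁻¹
    χ-edge (horiz i j j′ (_ , eq)) = begin
      parity (toℕ i + toℕ j′)             ≡⟨ cong (λ y → parity (toℕ i + y)) eq ⟩
      parity (toℕ i + (toℕ j + 1) % M)    ≡⟨ parity-+-cong (toℕ i) (parity-% (toℕ j + 1) 2∣M) ⟩
      parity (toℕ i + (toℕ j + 1))        ≡⟨ cong parity (+-assoc (toℕ i) (toℕ j) 1) ⟨
      parity (toℕ i + toℕ j + 1)          ≡⟨ cong parity (ℕ.+-comm (toℕ i + toℕ j) 1) ⟩
      parity (suc (toℕ i + toℕ j))        ≡⟨ parity-suc (toℕ i + toℕ j) ⟩
      parity (toℕ i + toℕ j) ⁻¹           ∎
      where open ≡-Reasoning
    χ-edge (vert i i′ j eq) = begin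
      parity (toℕ i′ + toℕ j)             ≡⟨ cong (λ x → parity (x + toℕ j)) eq ⟩
      parity (suc (toℕ i + toℕ j))        ≡⟨ parity-suc (toℕ i + toℕ j) ⟩
      parity (toℕ i + toℕ j) ⁻¹           ∎
      where open ≡-Reasoning
    χ-edge (twist i i′ j j′ i+1≡N i′≡0 (_ , eq)) = begin
      parity (toℕ i′ + toℕ j′)            ≡⟨ cong₂ (λ x y → parity (x + y)) i′≡0 eq ⟩
      parity ((toℕ j + r) % M)            ≡⟨ parity-% (toℕ j + r) 2∣M ⟩
      parity (toℕ j + r)                  ≡⟨ parity-+-cong (toℕ j) (2∣+⇒parity≡ N r 2∣N+r) ⟨
      parity (toℕ j + N)                  ≡⟨ cong (λ x → parity (toℕ j + x)) i+1≡N ⟨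
      parity (toℕ j + suc (toℕ i))        ≡⟨ cong parity (+-suc (toℕ j) (toℕ i)) ⟩
      parity (suc (toℕ j + toℕ i))        ≡⟨ cong (parity ∘ suc) (ℕ.+-comm (toℕ j) (toℕ i)) ⟩
      parity (suc (toℕ i + toℕ j))        ≡⟨ parity-suc (toℕ i + toℕ j) ⟩
      parity (toℕ i + toℕ j) ⁻¹           ∎
      where open ≡-Reasoning

    χ-proper : ProperColouring T χ
    χ-proper u v e χu≡χv = p≢p⁻¹ (χ u) (trans χu≡χv (χ-edge e))

theorem2p4 : (n m r : ℕ) → 1 ≤ n → 2 ≤ m → 1 ≤ r → r ≤ m →
    T-bipartite n m r ⇔ (2 ∣ m × 2 ∣ (n + r))
theorem2p4 (suc n′) (suc (suc k)) r (s≤s z≤n) (s≤s (s≤s z≤n)) _ _ = mk⇔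
  (λ (c , proper) → parity-colouring⇒even (recolour toParity-injective proper))
  (λ (2∣M , 2∣N+r) → fromParity ∘ χ , recolour fromParity-injective (χ-proper 2∣M 2∣N+r))
  where open Torus n′ k r
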